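{- Let $G$ be a partial graph with a local coloring, and let $S$ and $R$ be two $\to$-connected sub-graphs of $G$ having at least one vertex in common. Then $S\cup R$ is $\to$-connected.
   Context: A partial graph is a triple $(\mathcal V,\mathcal E,\psi)$ of disjoint finite sets of vertices and edges and a function $\psi$ giving each edge a set of at most two endpoints. A sub-graph is given by $\mathcal V'\subseteq\mathcal V$, $\mathcal E'\subseteq\mathcal E$ with $\psi'(e)=\psi(e)\cap\mathcal V'$; the union has the union of vertices and of edges. A path is an alternating sequence $(v_0,e_1,v_1,\dots,e_n,v_n)$ with the endpoints of $e_i$ exactly $v_{i-1}\neq v_i$; simple if edges are pairwise distinct and vertices pairwise distinct except possibly $v_0=v_n$; open if $v_0\neq v_n$. A local coloring $\mathsf c$ assigns a color to each $(e,w)$ with $w$ an endpoint of $e$. A cusp is a triple $(e,w,f)$ of distinct edges incident to $w$ with $\mathsf c(e,w)=\mathsf c(f,w)$; a path is cusp-free if no consecutive triple $(e_i,v_i,e_{i+1})$ is a cusp. Starting color $\mathsf c(e_1,v_0)$, ending color $\mathsf c(e_n,v_n)$. $(v,\alpha)\to_p(u,\beta)$ means $p$ is a simple open cusp-free path from $v$ to $u$ with starting color not $\alpha$ and ending color $\beta$. A sub-graph $S$ is $\to$-connected if for all distinct vertices $v,u$ of $S$ and every color $\alpha$ of $G$ there exist a path $p$ inside $S$ and a color $\beta$ with $(v,\alpha)\to_p(u,\beta)$. -}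

module Defs where

open import Data.Nat using (ℕ; suc; _≤_)
open import Data.Fin using (Fin; zero; suc; inject₁; fromℕ; toℕ)
open import Data.Fin.Subset using (Subset; _∈_; _∪_; _∩_; ⁅_⁆; ∣_∣; ⊤)
open import Data.Product using (Σ; _×_; ∃; ∃-syntax)
open import Data.Sum using (_⊎_)
open import Function.Definitions using (Injective)
open import Relation.Binary.PropositionalEquality using (_≡_; _≢_)
open import Relation.Nullary using (¬_)

-- Vertices and edges are drawn from the ambient finite
-- types Fin nV and Fin nE (two different types, hence disjoint).  A
-- partial graph on these carriers is a vertex set, an edge set and an
-- endpoint map (only its values on the edge set matter).

record PGraph (nV nE : ℕ) : Set where
  field
    verts : Subset nV
    edges : Subset nE
    ends  : Fin nE → Subset nV

open PGraph public

record Graph (nV nE : ℕ) : Set where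
  field
    ψ       : Fin nE → Subset nV
    ψ-small : ∀ e → ∣ ψ e ∣ ≤ 2

open Graph public

record SubGraph (nV nE : ℕ) : Set where
  constructor sub
  field
    V' : Subset nV
    E' : Subset nE

open SubGraph public

⟦_⟧ˢ : ∀ {nV nE} → SubGraph nV nE → Graph nV nE → PGraph nV nE
⟦ S ⟧ˢ G = record { verts = V' S ; edges = E' S ; ends = λ e → ψ G e ∩ V' S }

_∪ˢ_ : ∀ {nV nE} → SubGraph nV nE → SubGraph nV nE → SubGraph nV nE
S ∪ˢ R = sub (V' S ∪ V' R) (E' S ∪ E' R)

-- Local colorings with colors in a type C: a color c e w for each edge e
-- and endpoint w of e (values at non-endpoints are never consulted).

Coloring : ℕ → ℕ → Set → Set
Coloring nV nE C = Fin nE → Fin nV → C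

module _ {nV nE : ℕ} {C : Set} (c : Coloring nV nE C) (H : PGraph nV nE) where

  Cusp : Fin nE → Fin nV → Fin nE → Set
  Cusp e w f = e ≢ f × w ∈ ends H e × w ∈ ends H f × c e w ≡ c f w

  -- A path (v₀ , e₁ , v₁ , … , eₙ , vₙ) in H with n edges:
  -- edge i (0-based) goes from vert (inject₁ i) to vert (suc i).
  record Path (n : ℕ) : Set where
    field
      edge : Fin n → Fin nE
      vert : Fin (suc n) → Fin nV
      edge∈ : ∀ i → edge i ∈ edges H
      vert∈ : ∀ j → vert j ∈ verts H
      ends≡ : ∀ i → ends H (edge i) ≡ ⁅ vert (inject₁ i) ⁆ ∪ ⁅ vert (suc i) ⁆
      step≢ : ∀ i → vert (inject₁ i) ≢ vert (suc i)

  open Path public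

  Simple : ∀ {n} → Path n → Set
  Simple {n} p =
    Injective _≡_ _≡_ (edge p) ×
    (∀ i j → i ≢ j → vert p i ≡ vert p j →
       (i ≡ zero × j ≡ fromℕ n) ⊎ (i ≡ fromℕ n × j ≡ zero))

  Open : ∀ {n} → Path n → Set
  Open {n} p = vert p zero ≢ vert p (fromℕ n)

  CuspFree : ∀ {n} → Path n → Set
  CuspFree {n} p = ∀ (i j : Fin n) → toℕ j ≡ suc (toℕ i) →
    ¬ Cusp (edge p i) (vert p (suc i)) (edge p j)

  -- (v , α) →ₚ (u , β): p is a simple open cusp-free path from v to u whose
  -- starting color c(e₁ , v₀) is not α and whose ending color c(eₙ , vₙ) is β.
  -- (An open path has at least one edge, so we take n = suc m.)
  Arrow : ∀ {m} → Fin nV → C → Path (suc m) → Fin nV → C → Set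
  Arrow {m} v α p u β =
    Simple p × Open p × CuspFree p ×
    vert p zero ≡ v × vert p (fromℕ (suc m)) ≡ u ×
    c (edge p zero) (vert p zero) ≢ α ×
    c (edge p (fromℕ m)) (vert p (fromℕ (suc m))) ≡ β

ArrowConnected : ∀ {nV nE} {C : Set} → Graph nV nE → Coloring nV nE C →
                 SubGraph nV nE → Set
ArrowConnected {nV} {C = C} G c S =
  ∀ (v u : Fin nV) → v ∈ V' S → u ∈ V' S → v ≢ u → ∀ (α : C) →
  ∃[ m ] Σ (Path c (⟦ S ⟧ˢ G) (suc m)) λ p → ∃[ β ] Arrow c (⟦ S ⟧ˢ G) v α p u β

-- To join v ∈ S ∖ R to u ∈ R ∖ S, follow an S-path from v (with starting
-- color other than α) towards a common vertex x and stop at the first vertex w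
-- of R on it; then continue by an R-path from w to u whose starting color
-- differs from the color with which the S-path arrives at w.  The two pieces
-- meet only at w, and the choice of starting color is exactly what keeps w
-- from being a cusp.  Everything else is bookkeeping: a path of a sub-graph
-- stays a path of any larger sub-graph, because an edge joining two distinct
-- vertices of S has no further endpoint.
module Submission where

open import Defs
open import Data.Nat using (ℕ; zero; suc; _+_; _∸_; _≤_; _<_; z≤n; s≤s; _<?_)
open import Data.Nat.Properties
  using (≤-refl; ≤-trans; <⇒≤; ≤⇒≯; <-irrefl;
         n<1+n; m<n⇒m<1+n; m<1+n⇒m<n∨m≡n; m<1+n⇒m≤n;
         m≤m+n; +-suc; +-identityʳ; m+n∸m≡n; +-cancelˡ-≤; +-cancelˡ-<; module ≤-Reasoning)
open import Data.Fin using (Fin; zero; suc; toℕ; fromℕ; fromℕ<; inject₁)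
open import Data.Fin.Properties
  using (toℕ-fromℕ; toℕ-fromℕ<; toℕ-inject₁; toℕ<n; toℕ-injective; fromℕ<-toℕ; _≟_)
open import Data.Fin.Subset using (Subset; _∈_; _∉_; _⊆_; _∪_; _∩_; ⁅_⁆; ∣_∣)
open import Data.Fin.Subset.Properties
  using (_∈?_; x∈⁅x⁆; x∈⁅y⁆⇒x≡y; ∣⁅x⁆∣≡1; ⊆-antisym; p⊂q⇒∣p∣<∣q∣;
         p∩q⊆p; p∩q⊆q; x∈p∩q⁺; p⊆p∪q; q⊆p∪q; x∈p∪q⁻)
open import Data.Product using (Σ; ∃-syntax; _×_; _,_)
open import Data.Sum using (_⊎_; inj₁; inj₂)
import Data.Sum as Sum
open import Data.Empty using (⊥-elim)
open import Function using (_∘_)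
open import Function.Definitions using (Injective)
open import Relation.Nullary using (¬_; yes; no; contradiction)
open import Relation.Unary using (Decidable)
open import Relation.Binary.PropositionalEquality
  using (_≡_; _≢_; refl; sym; trans; cong; cong₂; subst; module ≡-Reasoning)

∈-pair⁻ : ∀ {n} {x a b : Fin n} → x ∈ ⁅ a ⁆ ∪ ⁅ b ⁆ → x ≡ a ⊎ x ≡ b
∈-pair⁻ {a = a} {b} = Sum.map (x∈⁅y⁆⇒x≡y a) (x∈⁅y⁆⇒x≡y b) ∘ x∈p∪q⁻ ⁅ a ⁆ ⁅ b ⁆

∈-pairˡ : ∀ {n} (a b : Fin n) → a ∈ ⁅ a ⁆ ∪ ⁅ b ⁆
∈-pairˡ a b = p⊆p∪q ⁅ b ⁆ (x∈⁅x⁆ a)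

∣pair∣≥2 : ∀ {n} {a b : Fin n} → a ≢ b → 2 ≤ ∣ ⁅ a ⁆ ∪ ⁅ b ⁆ ∣
∣pair∣≥2 {a = a} {b} a≢b =
  subst (_< ∣ ⁅ a ⁆ ∪ ⁅ b ⁆ ∣) (∣⁅x⁆∣≡1 a)
    (p⊂q⇒∣p∣<∣q∣ (p⊆p∪q ⁅ b ⁆ , b , q⊆p∪q ⁅ a ⁆ ⁅ b ⁆ (x∈⁅x⁆ b) ,
                  a≢b ∘ sym ∘ x∈⁅y⁆⇒x≡y a))

∣A∣≤2∧A∩X≡pair⇒A⊆X : ∀ {n} {A X : Subset n} {a b : Fin n} →
                      ∣ A ∣ ≤ 2 → A ∩ X ≡ ⁅ a ⁆ ∪ ⁅ b ⁆ → a ≢ b → A ⊆ X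
∣A∣≤2∧A∩X≡pair⇒A⊆X {A = A} {X} {a} {b} ∣A∣≤2 A∩X≡ab a≢b {w} w∈A with w ∈? X
... | yes w∈X = w∈X
... | no  w∉X = ⊥-elim (<-irrefl refl 2<2)
  where
  open ≤-Reasoning
  2<2 : 2 < 2
  2<2 = begin-strict
    2                    ≤⟨ ∣pair∣≥2 a≢b ⟩
    ∣ ⁅ a ⁆ ∪ ⁅ b ⁆ ∣    ≡⟨ cong ∣_∣ (sym A∩X≡ab) ⟩
    ∣ A ∩ X ∣            <⟨ p⊂q⇒∣p∣<∣q∣ (p∩q⊆p A X , w , w∈A , w∉X ∘ p∩q⊆q A X) ⟩
    ∣ A ∣                ≤⟨ ∣A∣≤2 ⟩
    2                    ∎

⊆⇒∩≡ : ∀ {n} {A X : Subset n} → A ⊆ X → A ∩ X ≡ A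
⊆⇒∩≡ {A = A} {X} A⊆X = ⊆-antisym (p∩q⊆p A X) (λ w∈A → x∈p∩q⁺ (w∈A , A⊆X w∈A))

data Cut (k : ℕ) : ℕ → Set where
  before : ∀ {i} → i < k → Cut k i
  after  : ∀ d → Cut k (k + d)

cut : ∀ k i → Cut k i
cut zero    i       = after i
cut (suc k) zero    = before (s≤s z≤n)
cut (suc k) (suc i) with cut k i
... | before i<k = before (s≤s i<k)
... | after d    = after d

least : ∀ {p} {P : ℕ → Set p} → Decidable P → ∀ {n} → P n →
        ∃[ k ] k ≤ n × P k × (∀ {j} → j < k → ¬ P j)
least P? {zero} P0 = 0 , z≤n , P0 , λ ()
least P? {suc n} Pn with P? 0
... | yes P0 = 0 , z≤n , P0 , λ ()
... | no ¬P0 with least (P? ∘ suc) Pn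
...   | k , k≤n , Pk , below =
  suc k , s≤s k≤n , Pk , λ { {zero} _ → ¬P0 ; {suc j} (s≤s j<k) → below j<k }

extend : ∀ {n} {A : Set} → (Fin (suc n) → A) → ℕ → A
extend {n} f i with i <? suc n
... | yes i<n = f (fromℕ< i<n)
... | no  _   = f zero

extend-≡ : ∀ {n} {A : Set} (f : Fin (suc n) → A) {x : Fin (suc n)} {i} → toℕ x ≡ i → extend f i ≡ f x
extend-≡ {n} f {x} refl with toℕ x <? suc n
... | yes x<n = cong f (fromℕ<-toℕ x x<n)
... | no  x≮n = contradiction (toℕ<n x) x≮n

extend-fromℕ< : ∀ {n} {A : Set} (f : Fin (suc n) → A) {i} (i<n : i < suc n) → extend f i ≡ f (fromℕ< i<n)
extend-fromℕ< f i<n = extend-≡ f (toℕ-fromℕ< i<n)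

extend-injective : ∀ {n} {A : Set} {f : Fin (suc n) → A} → Injective _≡_ _≡_ f →
                   ∀ {i j} → i < suc n → j < suc n → extend f i ≡ extend f j → i ≡ j
extend-injective {f = f} f-inj {i} {j} i<n j<n eq = begin
  i                     ≡⟨ toℕ-fromℕ< i<n ⟨
  toℕ (fromℕ< i<n)      ≡⟨ cong toℕ (f-inj fi≡fj) ⟩
  toℕ (fromℕ< j<n)      ≡⟨ toℕ-fromℕ< j<n ⟩
  j                     ∎
  where
  open ≡-Reasoning
  fi≡fj = trans (sym (extend-fromℕ< f i<n)) (trans eq (extend-fromℕ< f j<n))

module _ {nV nE : ℕ} {C : Set} (c : Coloring nV nE C) (H : PGraph nV nE) where

  -- A simple open cusp-free path with n edges, indexed by ℕ so that prefixes
  -- and concatenations need no index arithmetic in Fin; the values of edge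
  -- and vert outside the ranges < n and ≤ n are junk.  Injectivity of edge
  -- is not a field: it follows from that of vert (edge-injective).
  record Trail (n : ℕ) : Set where
    field
      edge  : ℕ → Fin nE
      vert  : ℕ → Fin nV
      edge∈ : ∀ {i} → i < n → edge i ∈ edges H
      vert∈ : ∀ {j} → j ≤ n → vert j ∈ verts H
      ends≡ : ∀ {i} → i < n → ends H (edge i) ≡ ⁅ vert i ⁆ ∪ ⁅ vert (suc i) ⁆
      vert-injective : ∀ {i j} → i ≤ n → j ≤ n → vert i ≡ vert j → i ≡ j
      cusp-free : ∀ {i} → suc i < n → ¬ Cusp c H (edge i) (vert (suc i)) (edge (suc i))

  open Trail public

  module _ {n : ℕ} (t : Trail n) where

    vert≢vert-suc : ∀ {i} → i < n → vert t i ≢ vert t (suc i)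
    vert≢vert-suc i<n vi≡vsi = <-irrefl (vert-injective t (<⇒≤ i<n) i<n vi≡vsi) ≤-refl

    edge-index : ∀ {i j} → i < n → j < n → edge t i ≡ edge t j → i ≡ j ⊎ i ≡ suc j
    edge-index {i} {j} i<n j<n ei≡ej =
      Sum.map (vert-injective t (<⇒≤ i<n) (<⇒≤ j<n)) (vert-injective t (<⇒≤ i<n) j<n)
        (∈-pair⁻ (subst (vert t i ∈_) (trans (cong (ends H) ei≡ej) (ends≡ t j<n))
                   (subst (vert t i ∈_) (sym (ends≡ t i<n)) (∈-pairˡ (vert t i) (vert t (suc i))))))

    edge-injective : ∀ {i j} → i < n → j < n → edge t i ≡ edge t j → i ≡ j
    edge-injective i<n j<n ei≡ej with edge-index i<n j<n ei≡ej | edge-index j<n i<n (sym ei≡ej)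
    ... | inj₁ i≡j   | _          = i≡j
    ... | _          | inj₁ j≡i   = sym j≡i
    ... | inj₂ i≡1+j | inj₂ j≡1+i =
      ⊥-elim (<-irrefl (trans i≡1+j (cong suc j≡1+i)) (m<n⇒m<1+n (n<1+n _)))

  simple∧open⇒vert-injective : ∀ {n} {p : Path c H n} →
                               Simple c H p → Open c H p → Injective _≡_ _≡_ (vert p)
  simple∧open⇒vert-injective (_ , vert-simple) is-open {i} {j} vi≡vj with i ≟ j
  ... | yes i≡j = i≡j
  ... | no  i≢j with vert-simple i j i≢j vi≡vj
  ...   | inj₁ (refl , refl) = contradiction vi≡vj is-open
  ...   | inj₂ (refl , refl) = contradiction (sym vi≡vj) is-open

  path⇒trail : ∀ {m} (p : Path c H (suc m)) → Simple c H p → Open c H p → CuspFree c H p → Trail (suc m)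
  path⇒trail {m} p simple is-open no-cusp = record
    { edge           = extend (edge p)
    ; vert           = extend (vert p)
    ; edge∈          = λ i<n → subst (_∈ edges H) (sym (extend-fromℕ< (edge p) i<n)) (edge∈ p _)
    ; vert∈          = λ j≤n → subst (_∈ verts H) (sym (extend-fromℕ< (vert p) (s≤s j≤n))) (vert∈ p _)
    ; ends≡          = ends≡′
    ; vert-injective = λ i≤n j≤n →
        extend-injective (simple∧open⇒vert-injective {p = p} simple is-open) (s≤s i≤n) (s≤s j≤n)
    ; cusp-free      = cusp-free′
    }
    where
    ends≡′ : ∀ {i} → i < suc m →
             ends H (extend (edge p) i) ≡ ⁅ extend (vert p) i ⁆ ∪ ⁅ extend (vert p) (suc i) ⁆
    ends≡′ i<n
      rewrite extend-fromℕ< (edge p) i<n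
            | extend-≡ (vert p) {inject₁ (fromℕ< i<n)} (trans (toℕ-inject₁ _) (toℕ-fromℕ< i<n))
            | extend-≡ (vert p) {suc (fromℕ< i<n)} (cong suc (toℕ-fromℕ< i<n))
            = ends≡ p (fromℕ< i<n)

    cusp-free′ : ∀ {i} → suc i < suc m →
                 ¬ Cusp c H (extend (edge p) i) (extend (vert p) (suc i)) (extend (edge p) (suc i))
    cusp-free′ 1+i<n
      rewrite extend-fromℕ< (edge p) (<⇒≤ 1+i<n)
            | extend-≡ (vert p) {suc (fromℕ< (<⇒≤ 1+i<n))} (cong suc (toℕ-fromℕ< (<⇒≤ 1+i<n)))
            | extend-fromℕ< (edge p) 1+i<n
            = no-cusp (fromℕ< (<⇒≤ 1+i<n)) (fromℕ< 1+i<n)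
                (trans (toℕ-fromℕ< 1+i<n) (cong suc (sym (toℕ-fromℕ< (<⇒≤ 1+i<n)))))

  module _ {m : ℕ} (t : Trail (suc m)) where

    trail⇒path : Path c H (suc m)
    trail⇒path = record
      { edge  = edge t ∘ toℕ
      ; vert  = vert t ∘ toℕ
      ; edge∈ = λ i → edge∈ t (toℕ<n i)
      ; vert∈ = λ j → vert∈ t (m<1+n⇒m≤n (toℕ<n j))
      ; ends≡ = λ i → subst (λ k → ends H (edge t (toℕ i)) ≡ ⁅ vert t k ⁆ ∪ ⁅ vert t (suc (toℕ i)) ⁆)
                            (sym (toℕ-inject₁ i)) (ends≡ t (toℕ<n i))
      ; step≢ = λ i → subst (λ k → vert t k ≢ vert t (suc (toℕ i))) (sym (toℕ-inject₁ i))
                            (vert≢vert-suc t (toℕ<n i))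
      }

    trail⇒path-simple : Simple c H trail⇒path
    trail⇒path-simple =
        (λ ei≡ej → toℕ-injective (edge-injective t (toℕ<n _) (toℕ<n _) ei≡ej))
      , λ i j i≢j vi≡vj →
          contradiction
            (toℕ-injective (vert-injective t (m<1+n⇒m≤n (toℕ<n i)) (m<1+n⇒m≤n (toℕ<n j)) vi≡vj)) i≢j

    trail⇒path-open : Open c H trail⇒path
    trail⇒path-open v0≡vn with vert-injective t z≤n (m<1+n⇒m≤n (toℕ<n (fromℕ (suc m)))) v0≡vn
    ... | 0≡n rewrite toℕ-fromℕ (suc m) = contradiction 0≡n (λ ())

    trail⇒path-cusp-free : CuspFree c H trail⇒path
    trail⇒path-cusp-free i j j≡1+i rewrite j≡1+i = cusp-free t (subst (_< suc m) j≡1+i (toℕ<n j))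

  take : ∀ {k n} → k ≤ n → Trail n → Trail k
  take k≤n t = record
    { edge           = edge t
    ; vert           = vert t
    ; edge∈          = λ i<k → edge∈ t (≤-trans i<k k≤n)
    ; vert∈          = λ j≤k → vert∈ t (≤-trans j≤k k≤n)
    ; ends≡          = λ i<k → ends≡ t (≤-trans i<k k≤n)
    ; vert-injective = λ i≤k j≤k → vert-injective t (≤-trans i≤k k≤n) (≤-trans j≤k k≤n)
    ; cusp-free      = λ 1+i<k → cusp-free t (≤-trans 1+i<k k≤n)
    }

  module Concat {k l : ℕ} (P : Trail (suc k)) (Q : Trail (suc l))
                (joined   : vert P (suc k) ≡ vert Q 0)
                (disjoint : ∀ {i j} → i ≤ k → j ≤ suc l → vert P i ≢ vert Q j)
                (no-cusp  : c (edge P k) (vert P (suc k)) ≢ c (edge Q 0) (vert Q 0)) where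

    K : ℕ
    K = suc k

    vert′ : ℕ → Fin nV
    vert′ j with j <? K
    ... | yes _ = vert P j
    ... | no  _ = vert Q (j ∸ K)

    edge′ : ℕ → Fin nE
    edge′ i with i <? K
    ... | yes _ = edge P i
    ... | no  _ = edge Q (i ∸ K)

    vert′-< : ∀ {j} → j < K → vert′ j ≡ vert P j
    vert′-< {j} j<K with j <? K
    ... | yes _   = refl
    ... | no  j≮K = contradiction j<K j≮K

    edge′-< : ∀ {i} → i < K → edge′ i ≡ edge P i
    edge′-< {i} i<K with i <? K
    ... | yes _   = refl
    ... | no  i≮K = contradiction i<K i≮K

    vert′-+ : ∀ d → vert′ (K + d) ≡ vert Q d
    vert′-+ d with K + d <? K
    ... | yes K+d<K = contradiction K+d<K (≤⇒≯ (m≤m+n K d))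
    ... | no  _     = cong (vert Q) (m+n∸m≡n K d)

    edge′-+ : ∀ d → edge′ (K + d) ≡ edge Q d
    edge′-+ d with K + d <? K
    ... | yes K+d<K = contradiction K+d<K (≤⇒≯ (m≤m+n K d))
    ... | no  _     = cong (edge Q) (m+n∸m≡n K d)

    vert′-suc-+ : ∀ d → vert′ (suc (K + d)) ≡ vert Q (suc d)
    vert′-suc-+ d = trans (cong vert′ (sym (+-suc K d))) (vert′-+ (suc d))

    edge′-suc-+ : ∀ d → edge′ (suc (K + d)) ≡ edge Q (suc d)
    edge′-suc-+ d = trans (cong edge′ (sym (+-suc K d))) (edge′-+ (suc d))

    vert′-K : vert′ K ≡ vert Q 0
    vert′-K = trans (cong vert′ (sym (+-identityʳ K))) (vert′-+ 0)

    edge′-K : edge′ K ≡ edge Q 0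
    edge′-K = trans (cong edge′ (sym (+-identityʳ K))) (edge′-+ 0)

    vert′-≤ : ∀ {j} → j ≤ K → vert′ j ≡ vert P j
    vert′-≤ j≤K with m<1+n⇒m<n∨m≡n (s≤s j≤K)
    ... | inj₁ j<K = vert′-< j<K
    ... | inj₂ refl = trans vert′-K (sym joined)

    edge∈′ : ∀ {i} → i < K + suc l → edge′ i ∈ edges H
    edge∈′ {i} i<n with cut K i
    ... | before i<K = subst (_∈ edges H) (sym (edge′-< i<K)) (edge∈ P i<K)
    ... | after d    = subst (_∈ edges H) (sym (edge′-+ d)) (edge∈ Q (+-cancelˡ-< K d (suc l) i<n))

    vert∈′ : ∀ {j} → j ≤ K + suc l → vert′ j ∈ verts H
    vert∈′ {j} j≤n with cut K j
    ... | before j<K = subst (_∈ verts H) (sym (vert′-< j<K)) (vert∈ P (<⇒≤ j<K))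
    ... | after d    = subst (_∈ verts H) (sym (vert′-+ d)) (vert∈ Q (+-cancelˡ-≤ K d (suc l) j≤n))

    ends≡′ : ∀ {i} → i < K + suc l → ends H (edge′ i) ≡ ⁅ vert′ i ⁆ ∪ ⁅ vert′ (suc i) ⁆
    ends≡′ {i} i<n with cut K i
    ... | before i<K rewrite edge′-< i<K | vert′-< i<K | vert′-≤ i<K = ends≡ P i<K
    ... | after d    rewrite edge′-+ d | vert′-+ d | vert′-suc-+ d = ends≡ Q (+-cancelˡ-< K d (suc l) i<n)

    vert-injective′ : ∀ {i j} → i ≤ K + suc l → j ≤ K + suc l → vert′ i ≡ vert′ j → i ≡ j
    vert-injective′ {i} {j} i≤n j≤n vi≡vj with cut K i | cut K j
    ... | before i<K | before j<K =
      vert-injective P (<⇒≤ i<K) (<⇒≤ j<K) (trans (sym (vert′-< i<K)) (trans vi≡vj (vert′-< j<K)))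
    ... | before i<K | after d =
      contradiction (trans (sym (vert′-< i<K)) (trans vi≡vj (vert′-+ d)))
                    (disjoint (m<1+n⇒m≤n i<K) (+-cancelˡ-≤ K d (suc l) j≤n))
    ... | after d | before j<K =
      contradiction (trans (sym (vert′-< j<K)) (trans (sym vi≡vj) (vert′-+ d)))
                    (disjoint (m<1+n⇒m≤n j<K) (+-cancelˡ-≤ K d (suc l) i≤n))
    ... | after d | after d′ =
      cong (K +_) (vert-injective Q (+-cancelˡ-≤ K d (suc l) i≤n) (+-cancelˡ-≤ K d′ (suc l) j≤n)
                    (trans (sym (vert′-+ d)) (trans vi≡vj (vert′-+ d′))))

    cusp-free′ : ∀ {i} → suc i < K + suc l → ¬ Cusp c H (edge′ i) (vert′ (suc i)) (edge′ (suc i))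
    cusp-free′ {i} 1+i<n with cut K i
    ... | after d rewrite edge′-+ d | vert′-suc-+ d | edge′-suc-+ d =
      cusp-free Q (+-cancelˡ-< K (suc d) (suc l) (subst (_< K + suc l) (sym (+-suc K d)) 1+i<n))
    ... | before i<K with m<1+n⇒m<n∨m≡n i<K
    ...   | inj₁ i<k rewrite edge′-< i<K | vert′-< (s≤s i<k) | edge′-< (s≤s i<k) = cusp-free P (s≤s i<k)
    ...   | inj₂ refl = λ (_ , _ , _ , same-colour) → no-cusp (begin
      c (edge P k) (vert P K)   ≡⟨ cong₂ c (edge′-< i<K) (vert′-≤ ≤-refl) ⟨
      c (edge′ k) (vert′ K)     ≡⟨ same-colour ⟩
      c (edge′ K) (vert′ K)     ≡⟨ cong₂ c edge′-K vert′-K ⟩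
      c (edge Q 0) (vert Q 0)   ∎)
      where open ≡-Reasoning

    trail : Trail (K + suc l)
    trail = record
      { edge = edge′ ; vert = vert′ ; edge∈ = edge∈′ ; vert∈ = vert∈′ ; ends≡ = ends≡′
      ; vert-injective = vert-injective′ ; cusp-free = cusp-free′ }

  -- Route v α u is (v , α) →ₚ (u , β) for some path p, with β left implicit:
  -- it is the arrival color below.
  record Route (v : Fin nV) (α : C) (u : Fin nV) : Set where
    field
      {len}      : ℕ
      trail      : Trail (suc len)
      starts     : vert trail 0 ≡ v
      finishes   : vert trail (suc len) ≡ u
      departure≢ : c (edge trail 0) (vert trail 0) ≢ α

  open Route public

  arrival : ∀ {v α u} → Route v α u → C
  arrival P = c (edge (trail P) (len P)) (vert (trail P) (suc (len P)))

  route⇒arrow : ∀ {v α u} → Route v α u →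
                ∃[ m ] Σ (Path c H (suc m)) λ p → ∃[ β ] Arrow c H v α p u β
  route⇒arrow {u = u} P =
      len P , trail⇒path t , _
    , trail⇒path-simple t , trail⇒path-open t , trail⇒path-cusp-free t
    , starts P , subst (λ j → vert t j ≡ u) (sym (toℕ-fromℕ (suc (len P)))) (finishes P)
    , departure≢ P , refl
    where t = trail P

  arrow⇒route : ∀ {m v α u β} {p : Path c H (suc m)} → Arrow c H v α p u β → Route v α u
  arrow⇒route {m} {p = p} (simple , is-open , no-cusp , v₀≡v , vₙ≡u , departure≢α , _) = record
    { trail      = path⇒trail p simple is-open no-cusp
    ; starts     = trans (extend-≡ (vert p) {zero} refl) v₀≡v
    ; finishes   = trans (extend-≡ (vert p) (toℕ-fromℕ (suc m))) vₙ≡u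
    ; departure≢ = departure≢α ∘
                   trans (sym (cong₂ c (extend-≡ (edge p) {zero} refl) (extend-≡ (vert p) {zero} refl)))
    }

  first-entry : ∀ (X : Subset nV) {v α x} → v ∉ X → x ∈ X → Route v α x →
                ∃[ w ] w ∈ X × Σ (Route v α w) λ P → ∀ {i} → i ≤ len P → vert (trail P) i ∉ X
  first-entry X v∉X x∈X P with least (λ j → vert (trail P) j ∈? X) (subst (_∈ X) (sym (finishes P)) x∈X)
  ... | zero  , _   , v∈X , _       = contradiction (subst (_∈ X) (starts P) v∈X) v∉X
  ... | suc k , k≤n , w∈X , outside =
      vert (trail P) (suc k) , w∈X
    , record { trail = take k≤n (trail P) ; starts = starts P ; finishes = refl ; departure≢ = departure≢ P }
    , outside ∘ s≤s

  splice : ∀ {v α w u} (P : Route v α w) (Q : Route w (arrival P) u) →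
           (∀ {i j} → i ≤ len P → j ≤ suc (len Q) → vert (trail P) i ≢ vert (trail Q) j) →
           Route v α u
  splice P Q disjoint = record
    { trail      = PQ.trail
    ; starts     = trans (PQ.vert′-< (s≤s z≤n)) (starts P)
    ; finishes   = trans (PQ.vert′-+ (suc (len Q))) (finishes Q)
    ; departure≢ = departure≢ P ∘
                   trans (sym (cong₂ c (PQ.edge′-< (s≤s z≤n)) (PQ.vert′-< (s≤s z≤n))))
    }
    where
    module PQ = Concat (trail P) (trail Q) (trans (finishes P) (sym (starts Q))) disjoint
                       (departure≢ Q ∘ sym)

_⊆ˢ_ : ∀ {nV nE} → SubGraph nV nE → SubGraph nV nE → Set
S ⊆ˢ T = V' S ⊆ V' T × E' S ⊆ E' T

S⊆ˢS∪ˢR : ∀ {nV nE} (S R : SubGraph nV nE) → S ⊆ˢ (S ∪ˢ R)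
S⊆ˢS∪ˢR S R = p⊆p∪q (V' R) , p⊆p∪q (E' R)

R⊆ˢS∪ˢR : ∀ {nV nE} (S R : SubGraph nV nE) → R ⊆ˢ (S ∪ˢ R)
R⊆ˢS∪ˢR S R = q⊆p∪q (V' S) (V' R) , q⊆p∪q (E' S) (E' R)

module _ {nV nE : ℕ} {C : Set} (G : Graph nV nE) (c : Coloring nV nE C) where

  trail-mono : ∀ {S T n} → S ⊆ˢ T → Trail c (⟦ S ⟧ˢ G) n → Trail c (⟦ T ⟧ˢ G) n
  trail-mono {S} {T} {n} (V⊆ , E⊆) t = record
    { edge           = edge t
    ; vert           = vert t
    ; edge∈          = E⊆ ∘ edge∈ t
    ; vert∈          = V⊆ ∘ vert∈ t
    ; ends≡          = λ i<n → trans (same-ends i<n) (ends≡ t i<n)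
    ; vert-injective = vert-injective t
    ; cusp-free      = λ { 1+i<n (e≢f , w∈e , w∈f , same-colour) → cusp-free t 1+i<n
        ( e≢f , subst (_ ∈_) (same-ends (<⇒≤ 1+i<n)) w∈e
        , subst (_ ∈_) (same-ends 1+i<n) w∈f , same-colour ) }
    }
    where
    same-ends : ∀ {i} → i < n → ψ G (edge t i) ∩ V' T ≡ ψ G (edge t i) ∩ V' S
    same-ends i<n = trans (⊆⇒∩≡ (λ w∈ψ → V⊆ (ψ⊆S w∈ψ))) (sym (⊆⇒∩≡ ψ⊆S))
      where
      ψ⊆S : ψ G (edge t _) ⊆ V' S
      ψ⊆S = ∣A∣≤2∧A∩X≡pair⇒A⊆X (ψ-small G _) (ends≡ t i<n) (vert≢vert-suc c _ t i<n)

  route-mono : ∀ {S T v α u} → S ⊆ˢ T → Route c (⟦ S ⟧ˢ G) v α u → Route c (⟦ T ⟧ˢ G) v α u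
  route-mono S⊆T P = record
    { trail      = trail-mono S⊆T (trail P)
    ; starts     = starts P
    ; finishes   = finishes P
    ; departure≢ = departure≢ P
    }

  routes : ∀ {S} → ArrowConnected G c S →
           ∀ {v u} → v ∈ V' S → u ∈ V' S → v ≢ u → ∀ α → Route c (⟦ S ⟧ˢ G) v α u
  routes S-conn {v} {u} v∈S u∈S v≢u α with S-conn v u v∈S u∈S v≢u α
  ... | _ , p , _ , arrow = arrow⇒route c _ {p = p} arrow

  crossing : ∀ {S R T} → S ⊆ˢ T → R ⊆ˢ T → ArrowConnected G c S → ArrowConnected G c R →
             ∀ {x v u} → x ∈ V' S → x ∈ V' R → v ∈ V' S → v ∉ V' R → u ∈ V' R → u ∉ V' S →
             ∀ α → Route c (⟦ T ⟧ˢ G) v α u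
  crossing {S} {R} S⊆T R⊆T S-conn R-conn {u = u} x∈S x∈R v∈S v∉R u∈R u∉S α
    with first-entry c _ (V' R) v∉R x∈R
           (routes S-conn v∈S x∈S (λ v≡x → v∉R (subst (_∈ V' R) (sym v≡x) x∈R)) α)
  ... | w , w∈R , P , P-avoids-R = splice c _ (route-mono S⊆T P) (route-mono R⊆T Q) disjoint
    where
    w∈S : w ∈ V' S
    w∈S = subst (_∈ V' S) (finishes P) (vert∈ (trail P) ≤-refl)

    Q : Route c (⟦ R ⟧ˢ G) w (arrival c _ P) u
    Q = routes R-conn w∈R u∈R (λ w≡u → u∉S (subst (_∈ V' S) w≡u w∈S)) (arrival c _ P)

    disjoint : ∀ {i j} → i ≤ len P → j ≤ suc (len Q) → vert (trail P) i ≢ vert (trail Q) j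
    disjoint i≤len j≤1+len vPi≡vQj =
      P-avoids-R i≤len (subst (_∈ V' R) (sym vPi≡vQj) (vert∈ (trail Q) j≤1+len))

  route-across : ∀ {S R T} → S ⊆ˢ T → R ⊆ˢ T → ArrowConnected G c S → ArrowConnected G c R →
                 ∀ {x v u} → x ∈ V' S → x ∈ V' R → v ∈ V' S → u ∈ V' R → v ≢ u →
                 ∀ α → Route c (⟦ T ⟧ˢ G) v α u
  route-across {S} {R} S⊆T R⊆T S-conn R-conn {v = v} {u} x∈S x∈R v∈S u∈R v≢u α
    with v ∈? V' R
  ... | yes v∈R = route-mono R⊆T (routes R-conn v∈R u∈R v≢u α)
  ... | no  v∉R with u ∈? V' S
  ...   | yes u∈S = route-mono S⊆T (routes S-conn v∈S u∈S v≢u α)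
  ...   | no  u∉S = crossing S⊆T R⊆T S-conn R-conn x∈S x∈R v∈S v∉R u∈R u∉S α

  union-route : ∀ {S R} → ArrowConnected G c S → ArrowConnected G c R →
                ∃[ x ] (x ∈ V' S × x ∈ V' R) →
                ∀ {v u} → v ∈ V' (S ∪ˢ R) → u ∈ V' (S ∪ˢ R) → v ≢ u →
                ∀ α → Route c (⟦ S ∪ˢ R ⟧ˢ G) v α u
  union-route {S} {R} S-conn R-conn (x , x∈S , x∈R) v∈S∪R u∈S∪R v≢u α
    with x∈p∪q⁻ (V' S) (V' R) v∈S∪R | x∈p∪q⁻ (V' S) (V' R) u∈S∪R
  ... | inj₁ v∈S | inj₁ u∈S = route-mono (S⊆ˢS∪ˢR S R) (routes S-conn v∈S u∈S v≢u α)
  ... | inj₂ v∈R | inj₂ u∈R = route-mono (R⊆ˢS∪ˢR S R) (routes R-conn v∈R u∈R v≢u α)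
  ... | inj₁ v∈S | inj₂ u∈R =
    route-across (S⊆ˢS∪ˢR S R) (R⊆ˢS∪ˢR S R) S-conn R-conn x∈S x∈R v∈S u∈R v≢u α
  ... | inj₂ v∈R | inj₁ u∈S =
    route-across (R⊆ˢS∪ˢR S R) (S⊆ˢS∪ˢR S R) R-conn S-conn x∈R x∈S v∈R u∈S v≢u α

lemma8p10 : ∀ {nV nE : ℕ} {C : Set} (G : Graph nV nE) (c : Coloring nV nE C)
            (S R : SubGraph nV nE) →
            ArrowConnected G c S → ArrowConnected G c R →
            (∃[ v ] (v ∈ V' S × v ∈ V' R)) →
            ArrowConnected G c (S ∪ˢ R)
lemma8p10 G c S R S-conn R-conn common v u v∈S∪R u∈S∪R v≢u α =
  route⇒arrow c _ (union-route G c S-conn R-conn common v∈S∪R u∈S∪R v≢u α)
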